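{- For all $k\in\mathbb{N}_{\geq 2}$ the class $K(\mathcal{H}_k)$ (closed under isomorphism) is a Fraïssé class, i.e. it has the Hereditary Property, the Joint Embedding Property and the Amalgamation Property.
   Context: For $m\geq 2$, an $m$-hypergraph is a structure $(V;R)$ with $R\subseteq\binom{V}{m}$ (a symmetric irreflexive $m$-ary relation). $\mathcal{H}_k$ is the class of all finite $k$-hypergraphs. For a $k$-hypergraph $H=(V;R)$, its Kay-graph is $K(H)=(V;R^{(k+1)})$ where $\{x_1,\dots,x_{k+1}\}\in R^{(k+1)}$ iff the number of $k$-element subsets of $\{x_1,\dots,x_{k+1}\}$ in $R$ is congruent to $k+1$ modulo $2$; $K(\mathcal{H}_k)=\{K(H):H\in\mathcal{H}_k\}$. HP: closed under substructures. JEP: any two members embed into a common member. AP: whenever $e:A\hookrightarrow B$, $f:A\hookrightarrow C$ are embeddings in the class, there are $D$ in the class and embeddings $g:B\hookrightarrow D$, $h:C\hookrightarrow D$ with $g\circ e=h\circ f$. -}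

module Defs where

open import Data.Nat using (ℕ; zero; suc; _+_; _≡ᵇ_; _%_; _≤_)
open import Data.Nat.Properties using (≡ᵇ⇒≡)
open import Data.Bool using (Bool; true; false; if_then_else_; _∧_; T)
open import Data.Bool.Properties using (T-∧)
open import Data.Fin using (Fin; zero; suc)
open import Data.Fin.Subset using (Subset; ⊥; ⁅_⁆; _∪_; ∣_∣)
open import Data.Vec using ([]; _∷_)
open import Data.Product using (Σ; ∃; _×_; _,_; proj₁)
open import Function using (_∘_; Injective)
open import Relation.Binary.PropositionalEquality using (_≡_; refl)
open import Function.Bundles using (Equivalence)

-- A finite m-hypergraph on vertex set Fin n: the relation is given by its
-- (decidable) characteristic function on subsets, and only m-element subsets
-- may be related (symmetric, irreflexive m-ary relation = set of m-subsets).
record Hyp (m : ℕ) : Set where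
  field
    size : ℕ
    R    : Subset size → Bool
    uniform : ∀ s → R s ≡ true → ∣ s ∣ ≡ m
open Hyp public

image : ∀ {n p} → (Fin n → Fin p) → Subset n → Subset p
image {zero}  f []      = ⊥
image {suc n} f (b ∷ s) =
  if b then ⁅ f zero ⁆ ∪ image (f ∘ suc) s else image (f ∘ suc) s

record Embedding {m : ℕ} (A B : Hyp m) : Set where
  field
    fun : Fin (size A) → Fin (size B)
    inj : Injective _≡_ _≡_ fun
    pres : ∀ s → R A s ≡ R B (image fun s)
open Embedding public

record Iso {m : ℕ} (A B : Hyp m) : Set where
  field
    emb  : Embedding A B
    surj : ∀ y → ∃ λ x → fun emb x ≡ y
open Iso public

countSub : ∀ {n} → (Subset n → Bool) → Subset n → ℕ
countSub {zero}  P []      = if P [] then 1 else 0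
countSub {suc n} P (b ∷ s) =
  countSub (P ∘ (false ∷_)) s + (if b then countSub (P ∘ (true ∷_)) s else 0)

kayR : (k : ℕ) (H : Hyp k) → Subset (size H) → Bool
kayR k H s = (∣ s ∣ ≡ᵇ suc k) ∧ ((countSub (R H) s % 2) ≡ᵇ (suc k % 2))

kay-uniform : (k : ℕ) (H : Hyp k) → ∀ s → kayR k H s ≡ true → ∣ s ∣ ≡ suc k
kay-uniform k H s e with ∣ s ∣ ≡ᵇ suc k in eq
... | true = ≡ᵇ⇒≡ ∣ s ∣ (suc k) (helper eq)
  where
    helper : ∀ {b} → b ≡ true → T b
    helper refl = _
kay-uniform k H s () | false

Kay : (k : ℕ) → Hyp k → Hyp (suc k)
Kay k H = record { size = size H ; R = kayR k H ; uniform = kay-uniform k H }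

InKay : (k : ℕ) → Hyp (suc k) → Set
InKay k G = Σ (Hyp k) λ H → Iso G (Kay k H)

HP : ∀ {m} → (Hyp m → Set) → Set
HP {m} C = ∀ (A B : Hyp m) → C B → Embedding A B → C A

JEP : ∀ {m} → (Hyp m → Set) → Set
JEP {m} C = ∀ (A B : Hyp m) → C A → C B →
  Σ (Hyp m) λ D → C D × Embedding A D × Embedding B D

AP : ∀ {m} → (Hyp m → Set) → Set
AP {m} C = ∀ (A B E : Hyp m) → C A → C B → C E →
  (e : Embedding A B) (f : Embedding A E) →
  Σ (Hyp m) λ D → C D × Σ (Embedding B D) λ g → Σ (Embedding E D) λ h →
    ∀ x → fun g (fun e x) ≡ fun h (fun f x)

-- Write ⨁ P t for the xor of P over all subsets of t. A (k+1)-set t is an edge of K(H) iff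
-- ⨁ (R H) t equals the parity of k + 1, so K(H) depends on H only through xor-sums over
-- subsets; in particular K commutes with restriction to a set of vertices, which gives HP.
--
-- For AP the key is a normal form. Given a vertex v of H, let N_v(H) be the k-hypergraph whose
-- edges are the k-sets s ∌ v for which K(H)(s ∪ {v}) differs from the parity of k. Then
-- K(N_v(H)) = K(H): on a (k+1)-set through v both xor-sums reduce to a single term, and on one
-- avoiding v the extra terms cancel because each (k−1)-subset lies in exactly two of its
-- k-subsets. Since N_v(H) is computed from K(H) alone, two k-hypergraphs whose Kay-graphs agree
-- on a common substructure A have normal forms, taken at a vertex of A, that agree on A; their
-- free amalgam is then a k-hypergraph whose Kay-graph amalgamates the two Kay-graphs. An empty
-- A needs no normalisation, and JEP is AP over the empty hypergraph.

module Submission where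

open import Algebra.Bundles using (CommutativeRing; IdempotentCommutativeMonoid)
open import Data.Bool using (Bool; true; false; not; _∧_; _∨_; _xor_; if_then_else_; T)
open import Data.Bool.Properties
  using ( ∧-zeroʳ; ∨-zeroʳ; ∧-conicalˡ; ∧-distribˡ-xor; not-involutive; not-distribˡ-xor
        ; xor-identityʳ; xor-same; xor-∧-commutativeRing)
  renaming (_≟_ to _≟ᴮ_)
open import Data.Fin using (Fin; zero; suc; _↑ˡ_; _↑ʳ_; splitAt)
open import Data.Fin.Properties using (any?; _≟_; ↑ˡ-injective; ↑ʳ-injective; splitAt-↑ˡ; splitAt-↑ʳ)
  renaming (suc-injective to Fin-suc-injective)
open import Data.Fin.Subset using (Subset; ⊥; ⁅_⁆; _∪_; ∣_∣)
open import Data.Fin.Subset.Properties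
  using (∪-assoc; ∪-identityˡ; ∪-identityʳ; ∪-idem; ∣⊥∣≡0; ∪-idempotentCommutativeMonoid)
open import Data.Nat using (ℕ; zero; suc; _+_; _≡ᵇ_; _%_; _<_; _≤_; s≤s)
open import Data.Nat.Properties using (≡ᵇ⇒≡; +-suc; +-identityʳ; suc-injective; n<1+n; <-trans)
open import Data.Product using (Σ; ∃; _×_; _,_)
open import Data.Unit using (⊤; tt)
open import Data.Vec using ([]; _∷_; lookup; tabulate)
open import Data.Vec.Properties
  using (lookup-zipWith; lookup-replicate; lookup∘tabulate; tabulate∘lookup; tabulate-cong; ≡-dec)
open import Function using (_∘_; Injective; id)
open import Relation.Binary.PropositionalEquality
  using (_≡_; _≢_; refl; sym; trans; cong; cong₂; subst; _≗_; module ≡-Reasoning)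
open import Relation.Nullary using (Dec; yes; no)

open import Defs
open import Algebra.Properties.CommutativeSemigroup
  (CommutativeRing.+-commutativeSemigroup xor-∧-commutativeRing) using () renaming (interchange to xor-interchange)

subset-ext : ∀ {n} {p q : Subset n} → (∀ i → lookup p i ≡ lookup q i) → p ≡ q
subset-ext {p = p} {q} h = trans (sym (tabulate∘lookup p)) (trans (tabulate-cong h) (tabulate∘lookup q))

lookup-∪ : ∀ {n} (p q : Subset n) i → lookup (p ∪ q) i ≡ (lookup p i ∨ lookup q i)
lookup-∪ p q i = lookup-zipWith _∨_ i p q

lookup-⊥ : ∀ {n} (i : Fin n) → lookup (⊥ {n}) i ≡ false
lookup-⊥ i = lookup-replicate i false

lookup-⁅x⁆-x : ∀ {n} (x : Fin n) → lookup ⁅ x ⁆ x ≡ true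
lookup-⁅x⁆-x zero = refl
lookup-⁅x⁆-x (suc x) = lookup-⁅x⁆-x x

lookup-⁅x⁆⇒≡ : ∀ {n} (x i : Fin n) → lookup ⁅ x ⁆ i ≡ true → x ≡ i
lookup-⁅x⁆⇒≡ zero zero _ = refl
lookup-⁅x⁆⇒≡ zero (suc i) e with () ← trans (sym e) (lookup-⊥ i)
lookup-⁅x⁆⇒≡ (suc x) (suc i) e = cong suc (lookup-⁅x⁆⇒≡ x i e)

lookup-⁅x⁆∪p-x : ∀ {n} (x : Fin n) p → lookup (⁅ x ⁆ ∪ p) x ≡ true
lookup-⁅x⁆∪p-x x p = trans (lookup-∪ ⁅ x ⁆ p x) (cong (_∨ lookup p x) (lookup-⁅x⁆-x x))

∣⁅x⁆∪p∣ : ∀ {n} (x : Fin n) p → lookup p x ≡ false → ∣ ⁅ x ⁆ ∪ p ∣ ≡ suc ∣ p ∣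
∣⁅x⁆∪p∣ zero (false ∷ p) _ = cong suc (cong ∣_∣ (∪-identityˡ p))
∣⁅x⁆∪p∣ (suc x) (false ∷ p) e = ∣⁅x⁆∪p∣ x p e
∣⁅x⁆∪p∣ (suc x) (true ∷ p) e = cong suc (∣⁅x⁆∪p∣ x p e)

remove : ∀ {n} → Fin n → Subset n → Subset n
remove zero (_ ∷ p) = false ∷ p
remove (suc x) (b ∷ p) = b ∷ remove x p

lookup-remove : ∀ {n} (x : Fin n) p → lookup (remove x p) x ≡ false
lookup-remove zero (_ ∷ p) = refl
lookup-remove (suc x) (_ ∷ p) = lookup-remove x p

⁅x⁆∪remove : ∀ {n} (x : Fin n) p → lookup p x ≡ true → ⁅ x ⁆ ∪ remove x p ≡ p
⁅x⁆∪remove zero (true ∷ p) _ = cong (true ∷_) (∪-identityˡ p)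
⁅x⁆∪remove (suc x) (b ∷ p) e = cong (b ∷_) (⁅x⁆∪remove x p e)

infix 4 _⊑_
_⊑_ : ∀ {n} → Subset n → Subset n → Set
p ⊑ q = ∀ i → lookup p i ≡ true → lookup q i ≡ true

∉-⊑ : ∀ {n} x (p q : Subset n) → p ⊑ q → lookup q x ≡ false → lookup p x ≡ false
∉-⊑ x p q p⊑q x∉q with lookup p x in eq
... | false = refl
... | true with () ← trans (sym (p⊑q x eq)) x∉q

∷-⊑ : ∀ {n} {p q : Subset n} b c → (b ≡ true → c ≡ true) → p ⊑ q → (b ∷ p) ⊑ (c ∷ q)
∷-⊑ b c b⇒c p⊑q zero = b⇒c
∷-⊑ b c b⇒c p⊑q (suc i) = p⊑q i

injective-∘suc : ∀ {n p} {f : Fin (suc n) → Fin p} → Injective _≡_ _≡_ f → Injective _≡_ _≡_ (f ∘ suc)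
injective-∘suc f-inj e = Fin-suc-injective (f-inj e)

image-⊥ : ∀ {n p} (f : Fin n → Fin p) → image f ⊥ ≡ ⊥
image-⊥ {zero} f = refl
image-⊥ {suc n} f = image-⊥ (f ∘ suc)

image-⁅⁆ : ∀ {n p} (f : Fin n → Fin p) x → image f ⁅ x ⁆ ≡ ⁅ f x ⁆
image-⁅⁆ f zero = trans (cong (⁅ f zero ⁆ ∪_) (image-⊥ (f ∘ suc))) (∪-identityʳ _)
image-⁅⁆ f (suc x) = image-⁅⁆ (f ∘ suc) x

image-cong : ∀ {n p} {f g : Fin n → Fin p} → f ≗ g → ∀ s → image f s ≡ image g s
image-cong {zero} f≗g [] = refl
image-cong {suc n} f≗g (false ∷ s) = image-cong (f≗g ∘ suc) s
image-cong {suc n} f≗g (true ∷ s) = cong₂ _∪_ (cong ⁅_⁆ (f≗g zero)) (image-cong (f≗g ∘ suc) s)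

lookup-image⁻ : ∀ {n p} (f : Fin n → Fin p) s y → lookup (image f s) y ≡ true →
  ∃ λ x → f x ≡ y × lookup s x ≡ true
lookup-image⁻ {zero} f [] y e with () ← trans (sym e) (lookup-⊥ y)
lookup-image⁻ {suc n} f (false ∷ s) y e with lookup-image⁻ (f ∘ suc) s y e
... | x , fx≡y , x∈s = suc x , fx≡y , x∈s
lookup-image⁻ {suc n} f (true ∷ s) y e with lookup ⁅ f zero ⁆ y in eq
... | true = zero , lookup-⁅x⁆⇒≡ (f zero) y eq , refl
... | false with lookup-image⁻ (f ∘ suc) s y
                   (trans (cong (_∨ lookup (image (f ∘ suc) s) y) (sym eq)) (trans (sym (lookup-∪ ⁅ f zero ⁆ _ y)) e))
...   | x , fx≡y , x∈s = suc x , fx≡y , x∈s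

lookup-image⁺ : ∀ {n p} (f : Fin n → Fin p) s x → lookup s x ≡ true → lookup (image f s) (f x) ≡ true
lookup-image⁺ f (true ∷ s) zero _ = lookup-⁅x⁆∪p-x (f zero) _
lookup-image⁺ f (false ∷ s) (suc x) e = lookup-image⁺ (f ∘ suc) s x e
lookup-image⁺ f (true ∷ s) (suc x) e =
  trans (lookup-∪ ⁅ f zero ⁆ _ (f (suc x)))
        (trans (cong (lookup ⁅ f zero ⁆ (f (suc x)) ∨_) (lookup-image⁺ (f ∘ suc) s x e)) (∨-zeroʳ _))

lookup-image : ∀ {n p} {f : Fin n → Fin p} → Injective _≡_ _≡_ f → ∀ s x →
  lookup (image f s) (f x) ≡ lookup s x
lookup-image {f = f} f-inj s x with lookup s x in x∈s
... | true = lookup-image⁺ f s x x∈s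
... | false with lookup (image f s) (f x) in fx∈fs
...   | false = refl
...   | true with lookup-image⁻ f s (f x) fx∈fs
...     | x′ , fx′≡fx , x′∈s with () ← trans (sym x′∈s) (trans (cong (lookup s) (f-inj fx′≡fx)) x∈s)

module _ {p : ℕ} where
  open import Algebra.Properties.IdempotentCommutativeMonoid (∪-idempotentCommutativeMonoid p)
    using (∙-distrˡ-∙)
  open import Algebra.Properties.CommutativeSemigroup
    (IdempotentCommutativeMonoid.commutativeSemigroup (∪-idempotentCommutativeMonoid p))
    using (x∙yz≈y∙xz)

  image-∪ : ∀ {n} (f : Fin n → Fin p) s t → image f (s ∪ t) ≡ image f s ∪ image f t
  image-∪ {zero} f [] [] = sym (∪-idem ⊥)
  image-∪ {suc n} f (false ∷ s) (false ∷ t) = image-∪ (f ∘ suc) s t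
  image-∪ {suc n} f (true ∷ s) (false ∷ t) =
    trans (cong (⁅ f zero ⁆ ∪_) (image-∪ (f ∘ suc) s t)) (sym (∪-assoc _ _ _))
  image-∪ {suc n} f (false ∷ s) (true ∷ t) =
    trans (cong (⁅ f zero ⁆ ∪_) (image-∪ (f ∘ suc) s t)) (x∙yz≈y∙xz _ _ _)
  image-∪ {suc n} f (true ∷ s) (true ∷ t) =
    trans (cong (⁅ f zero ⁆ ∪_) (image-∪ (f ∘ suc) s t)) (∙-distrˡ-∙ _ _ _)

image-∘ : ∀ {n p q} (g : Fin p → Fin q) (f : Fin n → Fin p) s → image (g ∘ f) s ≡ image g (image f s)
image-∘ {zero} g f [] = sym (image-⊥ g)
image-∘ {suc n} g f (false ∷ s) = image-∘ g (f ∘ suc) s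
image-∘ {suc n} g f (true ∷ s) =
  trans (cong₂ _∪_ (sym (image-⁅⁆ g (f zero))) (image-∘ g (f ∘ suc) s))
        (sym (image-∪ g ⁅ f zero ⁆ (image (f ∘ suc) s)))

image-id : ∀ {n} (s : Subset n) → image id s ≡ s
image-id s = subset-ext (lookup-image id s)

preimage : ∀ {n p} → (Fin n → Fin p) → Subset p → Subset n
preimage f t = tabulate (lookup t ∘ f)

preimage-image : ∀ {n p} {f : Fin n → Fin p} → Injective _≡_ _≡_ f → ∀ s → preimage f (image f s) ≡ s
preimage-image {f = f} f-inj s =
  subset-ext λ x → trans (lookup∘tabulate _ x) (lookup-image f-inj s x)

image-preimage : ∀ {n p} (f : Fin n → Fin p) t → (∀ y → lookup t y ≡ true → ∃ λ x → f x ≡ y) →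
  image f (preimage f t) ≡ t
image-preimage f t t⊆im = subset-ext lookup-image-preimage
  where
  lookup-image-preimage : ∀ y → lookup (image f (preimage f t)) y ≡ lookup t y
  lookup-image-preimage y with lookup t y in y∈t
  ... | true with t⊆im y y∈t
  ...   | x , refl = lookup-image⁺ f (preimage f t) x (trans (lookup∘tabulate _ x) y∈t)
  lookup-image-preimage y | false with lookup (image f (preimage f t)) y in y∈im
  ...   | false = refl
  ...   | true with lookup-image⁻ f (preimage f t) y y∈im
  ...     | x , refl , x∈pre with () ← trans (sym x∈pre) (trans (lookup∘tabulate _ x) y∈t)

f0∉image-f∘suc : ∀ {n p} {f : Fin (suc n) → Fin p} → Injective _≡_ _≡_ f → ∀ s →
  lookup (image (f ∘ suc) s) (f zero) ≡ false
f0∉image-f∘suc {f = f} f-inj s with lookup (image (f ∘ suc) s) (f zero) in eq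
... | false = refl
... | true with lookup-image⁻ (f ∘ suc) s (f zero) eq
...   | _ , e , _ with () ← f-inj e

∣image∣ : ∀ {n p} {f : Fin n → Fin p} → Injective _≡_ _≡_ f → ∀ s → ∣ image f s ∣ ≡ ∣ s ∣
∣image∣ {zero} {p} _ [] = ∣⊥∣≡0 p
∣image∣ {suc n} f-inj (false ∷ s) = ∣image∣ (injective-∘suc f-inj) s
∣image∣ {suc n} {f = f} f-inj (true ∷ s) =
  trans (∣⁅x⁆∪p∣ (f zero) (image (f ∘ suc) s) (f0∉image-f∘suc f-inj s))
        (cong suc (∣image∣ (injective-∘suc f-inj) s))

-- Parity and xor-sums over subsets

parity : ℕ → Bool
parity zero = false
parity (suc n) = not (parity n)

parity-+ : ∀ m n → parity (m + n) ≡ (parity m xor parity n)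
parity-+ zero n = refl
parity-+ (suc m) n = trans (cong not (parity-+ m n)) (not-distribˡ-xor (parity m) (parity n))

parity-n+n : ∀ n → parity (n + n) ≡ false
parity-n+n n = trans (parity-+ n n) (xor-same (parity n))

bit : Bool → ℕ
bit b = if b then 1 else 0

parity-bit : ∀ b → parity (bit b) ≡ b
parity-bit false = refl
parity-bit true = refl

%2≡bit∘parity : ∀ n → n % 2 ≡ bit (parity n)
%2≡bit∘parity zero = refl
%2≡bit∘parity (suc zero) = refl
%2≡bit∘parity (suc (suc n)) = trans (%2≡bit∘parity n) (cong bit (sym (not-involutive (parity n))))

bit-≡ᵇ : ∀ a b → (bit a ≡ᵇ bit b) ≡ not (a xor b)
bit-≡ᵇ false false = refl
bit-≡ᵇ false true = refl
bit-≡ᵇ true false = refl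
bit-≡ᵇ true true = refl

⨁ : ∀ {n} → (Subset n → Bool) → Subset n → Bool
⨁ {zero} P [] = P []
⨁ {suc n} P (b ∷ t) = ⨁ (P ∘ (false ∷_)) t xor (b ∧ ⨁ (P ∘ (true ∷_)) t)

parity-countSub : ∀ {n} (P : Subset n → Bool) t → parity (countSub P t) ≡ ⨁ P t
parity-countSub {zero} P [] = parity-bit (P [])
parity-countSub {suc n} P (false ∷ t) =
  trans (cong parity (+-identityʳ (countSub (P ∘ (false ∷_)) t)))
        (trans (parity-countSub (P ∘ (false ∷_)) t) (sym (xor-identityʳ _)))
parity-countSub {suc n} P (true ∷ t) =
  trans (parity-+ (countSub (P ∘ (false ∷_)) t) _) (cong₂ _xor_ (parity-countSub _ t) (parity-countSub _ t))

≡ᵇ≡true⇒≡ : ∀ {m n} → (m ≡ᵇ n) ≡ true → m ≡ n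
≡ᵇ≡true⇒≡ {m} {n} e = ≡ᵇ⇒≡ m n (subst T (sym e) tt)

≡ᵇ-refl : ∀ n → (n ≡ᵇ n) ≡ true
≡ᵇ-refl zero = refl
≡ᵇ-refl (suc n) = ≡ᵇ-refl n

∧-xor-interchange : ∀ b a₁ a₂ c₁ c₂ →
  ((a₁ xor a₂) xor (b ∧ (c₁ xor c₂))) ≡ ((a₁ xor (b ∧ c₁)) xor (a₂ xor (b ∧ c₂)))
∧-xor-interchange b a₁ a₂ c₁ c₂ =
  trans (cong ((a₁ xor a₂) xor_) (∧-distribˡ-xor b c₁ c₂)) (xor-interchange a₁ a₂ (b ∧ c₁) (b ∧ c₂))

⨁-cong-⊑ : ∀ {n} {P Q : Subset n → Bool} t → (∀ s → s ⊑ t → P s ≡ Q s) → ⨁ P t ≡ ⨁ Q t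
⨁-cong-⊑ {zero} [] h = h [] (λ ())
⨁-cong-⊑ {suc n} (false ∷ t) h =
  cong (_xor false) (⨁-cong-⊑ t (λ s s⊑t → h (false ∷ s) (∷-⊑ false false id s⊑t)))
⨁-cong-⊑ {suc n} (true ∷ t) h =
  cong₂ (λ x y → x xor y)
    (⨁-cong-⊑ t (λ s s⊑t → h (false ∷ s) (∷-⊑ false true (λ _ → refl) s⊑t)))
    (⨁-cong-⊑ t (λ s s⊑t → h (true ∷ s) (∷-⊑ true true id s⊑t)))

⨁-cong : ∀ {n} {P Q : Subset n → Bool} → P ≗ Q → ∀ t → ⨁ P t ≡ ⨁ Q t
⨁-cong P≗Q t = ⨁-cong-⊑ t (λ s _ → P≗Q s)

⨁-xor : ∀ {n} (P Q : Subset n → Bool) t → ⨁ (λ s → P s xor Q s) t ≡ (⨁ P t xor ⨁ Q t)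
⨁-xor {zero} P Q [] = refl
⨁-xor {suc n} P Q (b ∷ t) =
  trans (cong₂ (λ x y → x xor (b ∧ y)) (⨁-xor (P ∘ (false ∷_)) (Q ∘ (false ∷_)) t)
                                       (⨁-xor (P ∘ (true ∷_)) (Q ∘ (true ∷_)) t))
        (∧-xor-interchange b (⨁ (P ∘ (false ∷_)) t) (⨁ (Q ∘ (false ∷_)) t)
                             (⨁ (P ∘ (true ∷_)) t) (⨁ (Q ∘ (true ∷_)) t))

⨁-false : ∀ {n} (t : Subset n) → ⨁ (λ _ → false) t ≡ false
⨁-false {zero} [] = refl
⨁-false {suc n} (b ∷ t) = trans (cong₂ (λ x y → x xor (b ∧ y)) (⨁-false t) (⨁-false t)) (∧-zeroʳ b)

⨁-⊥ : ∀ {n} (P : Subset n → Bool) → ⨁ P ⊥ ≡ P ⊥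
⨁-⊥ {zero} P = refl
⨁-⊥ {suc n} P = trans (xor-identityʳ _) (⨁-⊥ (P ∘ (false ∷_)))

⨁-⁅x⁆∪ : ∀ {n} (P : Subset n → Bool) x u → lookup u x ≡ false →
  ⨁ P (⁅ x ⁆ ∪ u) ≡ (⨁ P u xor ⨁ (P ∘ (⁅ x ⁆ ∪_)) u)
⨁-⁅x⁆∪ P zero (false ∷ u) _ =
  trans (cong (λ t → ⨁ (P ∘ (false ∷_)) t xor ⨁ (P ∘ (true ∷_)) t) (∪-identityˡ u))
        (cong₂ _xor_ (sym (xor-identityʳ (⨁ (P ∘ (false ∷_)) u)))
                     (trans (⨁-cong (λ s → cong (P ∘ (true ∷_)) (sym (∪-identityˡ s))) u)
                            (sym (xor-identityʳ (⨁ (λ s → P (true ∷ (⊥ ∪ s))) u)))))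
⨁-⁅x⁆∪ P (suc x) (b ∷ u) x∉u =
  trans (cong₂ (λ y z → y xor (b ∧ z)) (⨁-⁅x⁆∪ (P ∘ (false ∷_)) x u x∉u)
                                       (⨁-⁅x⁆∪ (P ∘ (true ∷_)) x u x∉u))
        (∧-xor-interchange b (⨁ (P ∘ (false ∷_)) u) (⨁ (λ s → P (false ∷ (⁅ x ⁆ ∪ s))) u)
                             (⨁ (P ∘ (true ∷_)) u) (⨁ (λ s → P (true ∷ (⁅ x ⁆ ∪ s))) u))

⨁-image : ∀ {n p} (P : Subset p → Bool) {f : Fin n → Fin p} → Injective _≡_ _≡_ f → ∀ s →
  ⨁ (P ∘ image f) s ≡ ⨁ P (image f s)
⨁-image P f-inj [] = sym (⨁-⊥ P)
⨁-image P f-inj (false ∷ s) = trans (xor-identityʳ _) (⨁-image P (injective-∘suc f-inj) s)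
⨁-image P {f} f-inj (true ∷ s) =
  trans (cong₂ _xor_ (⨁-image P (injective-∘suc f-inj) s)
                     (⨁-image (P ∘ (⁅ f zero ⁆ ∪_)) (injective-∘suc f-inj) s))
        (sym (⨁-⁅x⁆∪ P (f zero) (image (f ∘ suc) s) (f0∉image-f∘suc f-inj s)))

atSize : ∀ {n} → ℕ → (Subset n → Bool) → Subset n → Bool
atSize j F s = (∣ s ∣ ≡ᵇ j) ∧ F s

⨁-atSize-> : ∀ {n} j (F : Subset n → Bool) t → ∣ t ∣ < j → ⨁ (atSize j F) t ≡ false
⨁-atSize-> {zero} (suc j) F [] _ = refl
⨁-atSize-> {suc n} j F (false ∷ t) ∣t∣<j = trans (xor-identityʳ _) (⨁-atSize-> j (F ∘ (false ∷_)) t ∣t∣<j)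
⨁-atSize-> {suc n} (suc j) F (true ∷ t) (s≤s ∣t∣<j) =
  cong₂ _xor_ (⨁-atSize-> (suc j) (F ∘ (false ∷_)) t (<-trans (n<1+n _) (s≤s ∣t∣<j)))
              (⨁-atSize-> j (F ∘ (true ∷_)) t ∣t∣<j)

⨁-atSize-∣t∣ : ∀ {n} (F : Subset n → Bool) t → ⨁ (atSize ∣ t ∣ F) t ≡ F t
⨁-atSize-∣t∣ {zero} F [] = refl
⨁-atSize-∣t∣ {suc n} F (false ∷ t) = trans (xor-identityʳ _) (⨁-atSize-∣t∣ (F ∘ (false ∷_)) t)
⨁-atSize-∣t∣ {suc n} F (true ∷ t) =
  trans (cong (_xor ⨁ (atSize ∣ t ∣ (F ∘ (true ∷_))) t) (⨁-atSize-> (suc ∣ t ∣) (F ∘ (false ∷_)) t (n<1+n _)))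
        (⨁-atSize-∣t∣ (F ∘ (true ∷_)) t)

atSize-⨁-atSize : ∀ {n} j (F : Subset n → Bool) → atSize j (⨁ (atSize j F)) ≗ atSize j F
atSize-⨁-atSize j F t with ∣ t ∣ ≡ᵇ j in eq
... | false = refl
... | true with ≡ᵇ≡true⇒≡ {∣ t ∣} {j} eq
...   | refl = ⨁-atSize-∣t∣ F t

∧-xor-absorb : ∀ q a b → ((q ∧ a) xor (a xor (not q ∧ b))) ≡ (not q ∧ (a xor b))
∧-xor-absorb false a b = refl
∧-xor-absorb true false b = refl
∧-xor-absorb true true b = refl

-- Each j-subset of t lies in ∣ t ∣ ∸ j of its (j + 1)-subsets, and ∣ t ∣ ∸ j ≡ ∣ t ∣ + j (mod 2).
⨁-double-count : ∀ {n} j (F : Subset n → Bool) t →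
  ⨁ (atSize (suc j) (⨁ (atSize j F))) t ≡ (parity (∣ t ∣ + j) ∧ ⨁ (atSize j F) t)
⨁-double-count zero F [] = refl
⨁-double-count (suc j) F [] = sym (∧-zeroʳ _)
⨁-double-count j F (false ∷ t) = begin
  ⨁ (atSize (suc j) (⨁ (atSize j F))) (false ∷ t)
    ≡⟨ xor-identityʳ _ ⟩
  ⨁ (λ s → atSize (suc j) (⨁ (atSize j F)) (false ∷ s)) t
    ≡⟨ ⨁-cong (λ s → cong ((∣ s ∣ ≡ᵇ suc j) ∧_) (xor-identityʳ _)) t ⟩
  ⨁ (atSize (suc j) (⨁ (atSize j (F ∘ (false ∷_))))) t
    ≡⟨ ⨁-double-count j (F ∘ (false ∷_)) t ⟩
  parity (∣ t ∣ + j) ∧ ⨁ (atSize j (F ∘ (false ∷_))) t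
    ≡⟨ cong (parity (∣ t ∣ + j) ∧_) (sym (xor-identityʳ _)) ⟩
  parity (∣ t ∣ + j) ∧ ⨁ (atSize j F) (false ∷ t) ∎
  where open ≡-Reasoning
⨁-double-count j F (true ∷ t) = begin
  ⨁ (atSize (suc j) (⨁ (atSize j F))) (true ∷ t)
    ≡⟨ cong₂ _xor_ (trans (⨁-cong (λ s → cong ((∣ s ∣ ≡ᵇ suc j) ∧_) (xor-identityʳ _)) t)
                          (⨁-double-count j (F ∘ (false ∷_)) t))
                   (trans (⨁-cong (λ s → ∧-distribˡ-xor (∣ s ∣ ≡ᵇ j) (A s) (B s)) t)
                          (⨁-xor (atSize j A) (atSize j B) t)) ⟩
  (q ∧ A t) xor (⨁ (atSize j A) t xor ⨁ (atSize j B) t)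
    ≡⟨ cong (λ x → (q ∧ A t) xor (x xor ⨁ (atSize j B) t)) (⨁-cong (atSize-⨁-atSize j (F ∘ (false ∷_))) t) ⟩
  (q ∧ A t) xor (A t xor ⨁ (atSize j B) t)
    ≡⟨ cong (λ x → (q ∧ A t) xor (A t xor x)) (⨁-atSize-B j) ⟩
  (q ∧ A t) xor (A t xor (not q ∧ B t))
    ≡⟨ ∧-xor-absorb q (A t) (B t) ⟩
  not q ∧ (A t xor B t) ∎
  where
  open ≡-Reasoning
  q = parity (∣ t ∣ + j)
  A B : Subset _ → Bool
  A = ⨁ (atSize j (F ∘ (false ∷_)))
  B = ⨁ (λ r → (suc ∣ r ∣ ≡ᵇ j) ∧ F (true ∷ r))
  ⨁-atSize-B : ∀ j → ⨁ (atSize j (⨁ (λ r → (suc ∣ r ∣ ≡ᵇ j) ∧ F (true ∷ r)))) t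
                    ≡ (not (parity (∣ t ∣ + j)) ∧ ⨁ (λ r → (suc ∣ r ∣ ≡ᵇ j) ∧ F (true ∷ r)) t)
  ⨁-atSize-B zero = begin
    ⨁ (atSize 0 (⨁ (λ _ → false))) t ≡⟨ ⨁-cong (λ s → trans (cong ((∣ s ∣ ≡ᵇ 0) ∧_) (⨁-false s)) (∧-zeroʳ _))
                                                t ⟩
    ⨁ (λ _ → false) t                 ≡⟨ ⨁-false t ⟩
    false                             ≡⟨ ∧-zeroʳ (not q₀) ⟨
    not q₀ ∧ false                    ≡⟨ cong (not q₀ ∧_) (⨁-false t) ⟨
    not q₀ ∧ ⨁ (λ _ → false) t        ∎
    where q₀ = parity (∣ t ∣ + 0)
  ⨁-atSize-B (suc j) = trans (⨁-double-count j (F ∘ (true ∷_)) t)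
    (cong (_∧ ⨁ (atSize j (F ∘ (true ∷_))) t)
          (trans (sym (not-involutive _)) (cong (not ∘ parity) (sym (+-suc ∣ t ∣ j)))))

kayOf : (k : ℕ) {n : ℕ} → (Subset n → Bool) → Subset n → Bool
kayOf k P s = (∣ s ∣ ≡ᵇ suc k) ∧ not (⨁ P s xor parity (suc k))

kayR≡kayOf : ∀ k (H : Hyp k) s → kayR k H s ≡ kayOf k (R H) s
kayR≡kayOf k H s = cong ((∣ s ∣ ≡ᵇ suc k) ∧_) (begin
  (countSub (R H) s % 2 ≡ᵇ suc k % 2)
    ≡⟨ cong₂ _≡ᵇ_ (%2≡bit∘parity (countSub (R H) s)) (%2≡bit∘parity (suc k)) ⟩
  (bit (parity (countSub (R H) s)) ≡ᵇ bit (parity (suc k)))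
    ≡⟨ bit-≡ᵇ (parity (countSub (R H) s)) (parity (suc k)) ⟩
  not (parity (countSub (R H) s) xor parity (suc k))
    ≡⟨ cong (λ b → not (b xor parity (suc k))) (parity-countSub (R H) s) ⟩
  not (⨁ (R H) s xor parity (suc k)) ∎)
  where open ≡-Reasoning

kayOf-of-size : ∀ k {n} (P : Subset n → Bool) s → ∣ s ∣ ≡ suc k → kayOf k P s ≡ not (⨁ P s xor parity (suc k))
kayOf-of-size k P s ∣s∣≡1+k =
  cong (_∧ not (⨁ P s xor parity (suc k))) (trans (cong (_≡ᵇ suc k) ∣s∣≡1+k) (≡ᵇ-refl (suc k)))

kayOf-cong : ∀ k {n} {P Q : Subset n → Bool} t → (∣ t ∣ ≡ suc k → ⨁ P t ≡ ⨁ Q t) →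
  kayOf k P t ≡ kayOf k Q t
kayOf-cong k {P = P} {Q} t same with ∣ t ∣ ≡ᵇ suc k in eq
... | false = refl
... | true = cong (λ x → not (x xor parity (suc k))) (same (≡ᵇ≡true⇒≡ eq))

kayOf-image : ∀ k {n p} (P : Subset p → Bool) {f : Fin n → Fin p} → Injective _≡_ _≡_ f → ∀ s →
  kayOf k (P ∘ image f) s ≡ kayOf k P (image f s)
kayOf-image k P f-inj s =
  cong₂ (λ m x → (m ≡ᵇ suc k) ∧ not (x xor parity (suc k))) (sym (∣image∣ f-inj s)) (⨁-image P f-inj s)

R≗atSize : ∀ {k} (H : Hyp k) → R H ≗ atSize k (R H)
R≗atSize {k} H s with R H s in eq
... | false = sym (∧-zeroʳ _)
... | true = sym (trans (cong (λ m → (m ≡ᵇ k) ∧ true) (uniform H s eq)) (cong (_∧ true) (≡ᵇ-refl k)))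

kayR-xor-parity : ∀ {k} (H : Hyp k) s → ∣ s ∣ ≡ suc k → (kayR k H s xor parity k) ≡ ⨁ (R H) s
kayR-xor-parity {k} H s ∣s∣≡1+k =
  trans (cong (_xor parity k) (trans (kayR≡kayOf k H s) (kayOf-of-size k (R H) s ∣s∣≡1+k)))
        (not-xor-not-xor (⨁ (R H) s) (parity k))
  where
  not-xor-not-xor : ∀ x p → (not (x xor not p) xor p) ≡ x
  not-xor-not-xor false false = refl
  not-xor-not-xor false true = refl
  not-xor-not-xor true false = refl
  not-xor-not-xor true true = refl

R-⊥ : ∀ {m} (H : Hyp (suc m)) → R H ⊥ ≡ false
R-⊥ {m} H with R H ⊥ in eq
... | false = refl
... | true with () ← trans (sym (∣⊥∣≡0 (size H))) (uniform H ⊥ eq)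

Embedding-trans : ∀ {m} {A B C : Hyp m} → Embedding A B → Embedding B C → Embedding A C
Embedding-trans {C = C} f g = record
  { fun = fun g ∘ fun f
  ; inj = inj f ∘ inj g
  ; pres = λ s → trans (pres f s) (trans (pres g (image (fun f) s)) (cong (R C) (sym (image-∘ (fun g) (fun f) s)))) }

≗⇒Iso : ∀ {m n} {P Q : Subset n → Bool} {P-uniform Q-uniform} → P ≗ Q →
  Iso {m} record { size = n ; R = P ; uniform = P-uniform } record { size = n ; R = Q ; uniform = Q-uniform }
≗⇒Iso {Q = Q} P≗Q = record
  { emb = record { fun = id ; inj = id ; pres = λ s → trans (P≗Q s) (cong Q (sym (image-id s))) }
  ; surj = λ y → y , refl }

Iso-refl : ∀ {m} (A : Hyp m) → Iso A A
Iso-refl A = ≗⇒Iso λ _ → refl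

restrict : ∀ {k n} (H : Hyp k) {f : Fin n → Fin (size H)} → Injective _≡_ _≡_ f → Hyp k
restrict {n = n} H {f} f-inj = record
  { size = n
  ; R = R H ∘ image f
  ; uniform = λ s e → trans (sym (∣image∣ f-inj s)) (uniform H (image f s) e) }

restrict-embedding : ∀ {k n} (H : Hyp k) {f : Fin n → Fin (size H)} (f-inj : Injective _≡_ _≡_ f) →
  Embedding (restrict H f-inj) H
restrict-embedding H {f} f-inj = record { fun = f ; inj = f-inj ; pres = λ _ → refl }

Kay-embedding : ∀ {k} {B D : Hyp k} → Embedding B D → Embedding (Kay k B) (Kay k D)
Kay-embedding {k} {B} {D} e = record { fun = fun e ; inj = inj e ; pres = kay-pres }
  where
  kay-pres : ∀ s → kayR k B s ≡ kayR k D (image (fun e) s)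
  kay-pres s = begin
    kayR k B s                         ≡⟨ kayR≡kayOf k B s ⟩
    kayOf k (R B) s                    ≡⟨ kayOf-cong k s (λ _ → ⨁-cong (pres e) s) ⟩
    kayOf k (R D ∘ image (fun e)) s    ≡⟨ kayOf-image k (R D) (inj e) s ⟩
    kayOf k (R D) (image (fun e) s)    ≡⟨ kayR≡kayOf k D (image (fun e) s) ⟨
    kayR k D (image (fun e) s)         ∎
    where open ≡-Reasoning

-- Normal forms

normalPred : ∀ {k} (G : Hyp (suc k)) → Fin (size G) → Subset (size G) → Bool
normalPred {k} G v s = not (lookup s v) ∧ (R G (⁅ v ⁆ ∪ s) xor parity k)

normalR : ∀ {k} (G : Hyp (suc k)) → Fin (size G) → Subset (size G) → Bool
normalR {k} G v = atSize k (normalPred G v)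

normalise : ∀ {k} (H : Hyp k) → Fin (size H) → Hyp k
normalise H v = record
  { size = size H
  ; R = normalR (Kay _ H) v
  ; uniform = λ s e → ≡ᵇ≡true⇒≡ (∧-conicalˡ _ _ e) }

⨁-normalR-∋ : ∀ {k} (H : Hyp k) v u → lookup u v ≡ false → ∣ u ∣ ≡ k →
  ⨁ (normalR (Kay k H) v) (⁅ v ⁆ ∪ u) ≡ ⨁ (R H) (⁅ v ⁆ ∪ u)
⨁-normalR-∋ {k} H v u v∉u ∣u∣≡k = begin
  ⨁ (normalR (Kay k H) v) (⁅ v ⁆ ∪ u)
    ≡⟨ ⨁-⁅x⁆∪ (normalR (Kay k H) v) v u v∉u ⟩
  ⨁ (normalR (Kay k H) v) u xor ⨁ (normalR (Kay k H) v ∘ (⁅ v ⁆ ∪_)) u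
    ≡⟨ cong₂ _xor_ at-u (trans (⨁-cong vanish u) (⨁-false u)) ⟩
  ⨁ (R H) (⁅ v ⁆ ∪ u) xor false
    ≡⟨ xor-identityʳ _ ⟩
  ⨁ (R H) (⁅ v ⁆ ∪ u) ∎
  where
  open ≡-Reasoning
  at-u : ⨁ (normalR (Kay k H) v) u ≡ ⨁ (R H) (⁅ v ⁆ ∪ u)
  at-u = trans (cong (λ m → ⨁ (atSize m (normalPred (Kay k H) v)) u) (sym ∣u∣≡k))
         (trans (⨁-atSize-∣t∣ (normalPred (Kay k H) v) u)
         (trans (cong (λ b → not b ∧ (kayR k H (⁅ v ⁆ ∪ u) xor parity k)) v∉u)
                (kayR-xor-parity H (⁅ v ⁆ ∪ u) (trans (∣⁅x⁆∪p∣ v u v∉u) (cong suc ∣u∣≡k)))))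
  vanish : ∀ s → normalR (Kay k H) v (⁅ v ⁆ ∪ s) ≡ false
  vanish s = trans (cong (λ b → (∣ ⁅ v ⁆ ∪ s ∣ ≡ᵇ k) ∧ (not b ∧ (kayR k H (⁅ v ⁆ ∪ (⁅ v ⁆ ∪ s)) xor parity k)))
                         (lookup-⁅x⁆∪p-x v s))
                   (∧-zeroʳ _)

⨁-normalR-∌ : ∀ {j} (H : Hyp (suc j)) v t → lookup t v ≡ false → ∣ t ∣ ≡ suc (suc j) →
  ⨁ (normalR (Kay (suc j) H) v) t ≡ ⨁ (R H) t
⨁-normalR-∌ {j} H v t v∉t ∣t∣≡2+j = begin
  ⨁ (normalR (Kay (suc j) H) v) t
    ≡⟨ ⨁-cong-⊑ t split ⟩
  ⨁ (λ s → atSize k (λ s → ⨁ (R H) s xor ⨁ link s) s) t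
    ≡⟨ ⨁-cong (λ s → ∧-distribˡ-xor (∣ s ∣ ≡ᵇ k) (⨁ (R H) s) (⨁ link s)) t ⟩
  ⨁ (λ s → atSize k (⨁ (R H)) s xor atSize k (⨁ link) s) t
    ≡⟨ ⨁-xor (atSize k (⨁ (R H))) (atSize k (⨁ link)) t ⟩
  ⨁ (atSize k (⨁ (R H))) t xor ⨁ (atSize k (⨁ link)) t
    ≡⟨ cong₂ _xor_ (⨁-cong edges t) links-cancel ⟩
  ⨁ (R H) t xor false
    ≡⟨ xor-identityʳ _ ⟩
  ⨁ (R H) t ∎
  where
  open ≡-Reasoning
  k = suc j
  link = R H ∘ (⁅ v ⁆ ∪_)
  split : ∀ s → s ⊑ t → normalR (Kay (suc j) H) v s ≡ atSize k (λ s → ⨁ (R H) s xor ⨁ link s) s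
  split s s⊑t with ∣ s ∣ ≡ᵇ k in ∣s∣≡ᵇk
  ... | false = refl
  ... | true = begin
    not (lookup s v) ∧ (kayR k H (⁅ v ⁆ ∪ s) xor parity k)
      ≡⟨ cong (λ b → not b ∧ (kayR k H (⁅ v ⁆ ∪ s) xor parity k)) v∉s ⟩
    kayR k H (⁅ v ⁆ ∪ s) xor parity k
      ≡⟨ kayR-xor-parity H (⁅ v ⁆ ∪ s) (trans (∣⁅x⁆∪p∣ v s v∉s) (cong suc (≡ᵇ≡true⇒≡ ∣s∣≡ᵇk))) ⟩
    ⨁ (R H) (⁅ v ⁆ ∪ s)
      ≡⟨ ⨁-⁅x⁆∪ (R H) v s v∉s ⟩
    ⨁ (R H) s xor ⨁ link s ∎
    where v∉s = ∉-⊑ v s t s⊑t v∉t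
  edges : atSize k (⨁ (R H)) ≗ R H
  edges s = trans (cong ((∣ s ∣ ≡ᵇ k) ∧_) (⨁-cong (R≗atSize H) s))
                  (trans (atSize-⨁-atSize k (R H) s) (sym (R≗atSize H s)))
  link≗atSize : ∀ s → s ⊑ t → ∀ r → r ⊑ s → link r ≡ atSize j link r
  link≗atSize s s⊑t r r⊑s =
    trans (R≗atSize H (⁅ v ⁆ ∪ r))
          (cong (λ m → (m ≡ᵇ k) ∧ link r) (∣⁅x⁆∪p∣ v r (∉-⊑ v r t (λ i → s⊑t i ∘ r⊑s i) v∉t)))
  links-cancel : ⨁ (atSize k (⨁ link)) t ≡ false
  links-cancel = begin
    ⨁ (atSize k (⨁ link)) t
      ≡⟨ ⨁-cong-⊑ t (λ s s⊑t → cong ((∣ s ∣ ≡ᵇ k) ∧_) (⨁-cong-⊑ s (link≗atSize s s⊑t))) ⟩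
    ⨁ (atSize k (⨁ (atSize j link))) t
      ≡⟨ ⨁-double-count j link t ⟩
    parity (∣ t ∣ + j) ∧ ⨁ (atSize j link) t
      ≡⟨ cong (λ m → parity (m + j) ∧ ⨁ (atSize j link) t) ∣t∣≡2+j ⟩
    not (not (parity (j + j))) ∧ ⨁ (atSize j link) t
      ≡⟨ cong (_∧ ⨁ (atSize j link) t) (trans (not-involutive _) (parity-n+n j)) ⟩
    false ∎

⨁-normalR : ∀ {j} (H : Hyp (suc j)) v t → ∣ t ∣ ≡ suc (suc j) → ⨁ (normalR (Kay (suc j) H) v) t ≡ ⨁ (R H) t
⨁-normalR {j} H v t ∣t∣≡2+j with lookup t v in v∈t
... | false = ⨁-normalR-∌ H v t v∈t ∣t∣≡2+j
... | true = subst (λ t → ⨁ (normalR (Kay (suc j) H) v) t ≡ ⨁ (R H) t) (⁅x⁆∪remove v t v∈t)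
               (⨁-normalR-∋ H v u (lookup-remove v t) ∣u∣≡1+j)
  where
  u = remove v t
  ∣u∣≡1+j : ∣ u ∣ ≡ suc j
  ∣u∣≡1+j = suc-injective (trans (sym (∣⁅x⁆∪p∣ v u (lookup-remove v t)))
                                 (trans (cong ∣_∣ (⁅x⁆∪remove v t v∈t)) ∣t∣≡2+j))

kayR-normalise : ∀ {j} (H : Hyp (suc j)) v → kayR (suc j) (normalise H v) ≗ kayR (suc j) H
kayR-normalise {j} H v t =
  trans (kayR≡kayOf _ (normalise H v) t)
        (trans (kayOf-cong (suc j) t (⨁-normalR H v t)) (sym (kayR≡kayOf _ H t)))

normalR-image : ∀ {k} {G G′ : Hyp (suc k)} (e : Embedding G G′) v s →
  normalR G′ (fun e v) (image (fun e) s) ≡ normalR G v s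
normalR-image {k} {G} {G′} e v s =
  cong₃ (λ m b r → (m ≡ᵇ k) ∧ (not b ∧ (r xor parity k)))
        (∣image∣ (inj e) s) (lookup-image (inj e) s v) (sym (pres-⁅v⁆∪ s))
  where
  cong₃ : ∀ {A B C D : Set} (g : A → B → C → D) {a a′ b b′ c c′} →
    a ≡ a′ → b ≡ b′ → c ≡ c′ → g a b c ≡ g a′ b′ c′
  cong₃ g refl refl refl = refl
  pres-⁅v⁆∪ : ∀ s → R G (⁅ v ⁆ ∪ s) ≡ R G′ (⁅ fun e v ⁆ ∪ image (fun e) s)
  pres-⁅v⁆∪ s = trans (pres e (⁅ v ⁆ ∪ s))
                      (cong (R G′) (trans (image-∪ (fun e) ⁅ v ⁆ s) (cong (_∪ _) (image-⁅⁆ (fun e) v))))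

-- Free amalgamation of k-hypergraphs

Amalgam : ∀ {m} → (Hyp m → Set) → {A B E : Hyp m} → Embedding A B → Embedding A E → Set
Amalgam {m} C {B = B} {E} e f =
  Σ (Hyp m) λ D → C D × Σ (Embedding B D) λ g → Σ (Embedding E D) λ h → ∀ x → fun g (fun e x) ≡ fun h (fun f x)

↑ˡ≢↑ʳ : ∀ {m n} (i : Fin m) (j : Fin n) → i ↑ˡ n ≢ m ↑ʳ j
↑ˡ≢↑ʳ {m} {n} i j e with () ← trans (sym (splitAt-↑ˡ m i n)) (trans (cong (splitAt m) e) (splitAt-↑ʳ m n j))

module FreeAmalgam {k} {A B E : Hyp k} (e : Embedding A B) (f : Embedding A E) where

  nB = size B
  nE = size E

  ιB : Fin nB → Fin (nB + nE)
  ιB i = i ↑ˡ nE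

  ιB-inj : Injective _≡_ _≡_ ιB
  ιB-inj {x} {y} = ↑ˡ-injective nE x y

  -- a vertex of E in the image of A is glued to the corresponding vertex of B
  ιE-by : (y : Fin nE) → Dec (∃ λ x → fun f x ≡ y) → Fin (nB + nE)
  ιE-by y (yes (x , _)) = ιB (fun e x)
  ιE-by y (no _) = nB ↑ʳ y

  ιE : Fin nE → Fin (nB + nE)
  ιE y = ιE-by y (any? λ x → fun f x ≟ y)

  ιE∘f : ∀ x → ιE (fun f x) ≡ ιB (fun e x)
  ιE∘f x = go (any? λ x′ → fun f x′ ≟ fun f x)
    where
    go : ∀ d → ιE-by (fun f x) d ≡ ιB (fun e x)
    go (yes (x′ , fx′≡fx)) = cong (ιB ∘ fun e) (inj f fx′≡fx)
    go (no ∄x) with () ← ∄x (x , refl)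

  ιE-inj : Injective _≡_ _≡_ ιE
  ιE-inj {y₁} {y₂} = go (any? λ x → fun f x ≟ y₁) (any? λ x → fun f x ≟ y₂)
    where
    go : ∀ d₁ d₂ → ιE-by y₁ d₁ ≡ ιE-by y₂ d₂ → y₁ ≡ y₂
    go (yes (x₁ , p₁)) (yes (x₂ , p₂)) eq = trans (sym p₁) (trans (cong (fun f) (inj e (ιB-inj eq))) p₂)
    go (yes (x₁ , _)) (no _) eq with () ← ↑ˡ≢↑ʳ (fun e x₁) y₂ eq
    go (no _) (yes (x₂ , _)) eq with () ← ↑ˡ≢↑ʳ (fun e x₂) y₁ (sym eq)
    go (no _) (no _) eq = ↑ʳ-injective nB y₁ y₂ eq

  ιE-preimage-in-B : ∀ y i → ιB i ≡ ιE y → ∃ λ x → fun f x ≡ y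
  ιE-preimage-in-B y i = go (any? λ x → fun f x ≟ y)
    where
    go : ∀ d → ιB i ≡ ιE-by y d → ∃ λ x → fun f x ≡ y
    go (yes w) _ = w
    go (no _) eq with () ← ↑ˡ≢↑ʳ i y eq

  InB InE : Subset (nB + nE) → Set
  InB t = image ιB (preimage ιB t) ≡ t
  InE t = image ιE (preimage ιE t) ≡ t

  RD-by : ∀ t → Dec (InB t) → Dec (InE t) → Bool
  RD-by t (yes _) _ = R B (preimage ιB t)
  RD-by t (no _) (yes _) = R E (preimage ιE t)
  RD-by t (no _) (no _) = false

  RD : Subset (nB + nE) → Bool
  RD t = RD-by t (≡-dec _≟ᴮ_ _ t) (≡-dec _≟ᴮ_ _ t)

  RD-uniform : ∀ t → RD t ≡ true → ∣ t ∣ ≡ k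
  RD-uniform t = go (≡-dec _≟ᴮ_ _ t) (≡-dec _≟ᴮ_ _ t)
    where
    go : ∀ dB dE → RD-by t dB dE ≡ true → ∣ t ∣ ≡ k
    go (yes t∈B) _ r = trans (cong ∣_∣ (sym t∈B)) (trans (∣image∣ ιB-inj _) (uniform B _ r))
    go (no _) (yes t∈E) r = trans (cong ∣_∣ (sym t∈E)) (trans (∣image∣ ιE-inj _) (uniform E _ r))

  D : Hyp k
  D = record { size = nB + nE ; R = RD ; uniform = RD-uniform }

  B↪D : Embedding B D
  B↪D = record { fun = ιB ; inj = ιB-inj ; pres = λ s → sym (go s (≡-dec _≟ᴮ_ _ _) (≡-dec _≟ᴮ_ _ _)) }
    where
    go : ∀ s dB dE → RD-by (image ιB s) dB dE ≡ R B s
    go s (yes _) _ = cong (R B) (preimage-image ιB-inj s)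
    go s (no s∉B) _ with () ← s∉B (cong (image ιB) (preimage-image ιB-inj s))

  E↪D : Embedding E D
  E↪D = record { fun = ιE ; inj = ιE-inj ; pres = λ t → sym (go t (≡-dec _≟ᴮ_ _ _) (≡-dec _≟ᴮ_ _ _)) }
    where
    go : ∀ t dB dE → RD-by (image ιE t) dB dE ≡ R E t
    go t (no _) (yes _) = cong (R E) (preimage-image ιE-inj t)
    go t (no _) (no t∉E) with () ← t∉E (cong (image ιE) (preimage-image ιE-inj t))
    go t (yes t∈B) _ = begin
      R B (preimage ιB (image ιE t))            ≡⟨ cong (R B ∘ preimage ιB) image-ιE-t ⟩
      R B (preimage ιB (image ιB (image (fun e) s)))
                                                 ≡⟨ cong (R B) (preimage-image ιB-inj (image (fun e) s)) ⟩
      R B (image (fun e) s)                      ≡⟨ pres e s ⟨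
      R A s                                      ≡⟨ pres f s ⟩
      R E (image (fun f) s)                      ≡⟨ cong (R E) t≡f[s] ⟩
      R E t                                      ∎
      where
      open ≡-Reasoning
      s = preimage (fun f) t
      t⊆f[A] : ∀ y → lookup t y ≡ true → ∃ λ x → fun f x ≡ y
      t⊆f[A] y y∈t with lookup-image⁻ ιB _ (ιE y)
                          (subst (λ u → lookup u (ιE y) ≡ true) (sym t∈B) (lookup-image⁺ ιE t y y∈t))
      ... | i , ιBi≡ιEy , _ = ιE-preimage-in-B y i ιBi≡ιEy
      t≡f[s] : image (fun f) s ≡ t
      t≡f[s] = image-preimage (fun f) t t⊆f[A]
      image-ιE-t : image ιE t ≡ image ιB (image (fun e) s)
      image-ιE-t = begin
        image ιE t                        ≡⟨ cong (image ιE) t≡f[s] ⟨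
        image ιE (image (fun f) s)        ≡⟨ image-∘ ιE (fun f) s ⟨
        image (ιE ∘ fun f) s              ≡⟨ image-cong ιE∘f s ⟩
        image (ιB ∘ fun e) s              ≡⟨ image-∘ ιB (fun e) s ⟩
        image ιB (image (fun e) s)        ∎

amalgamate : ∀ {k} {A B E : Hyp k} (e : Embedding A B) (f : Embedding A E) → Amalgam (λ _ → ⊤) e f
amalgamate e f = D , tt , B↪D , E↪D , λ x → sym (ιE∘f x)
  where open FreeAmalgam e f

Kay-amalgamate-via : ∀ {k} {A : Hyp (suc k)} {HB HE NB NE : Hyp k}
  (eB : Embedding A (Kay k HB)) (eE : Embedding A (Kay k HE))
  (nB : Embedding (Kay k HB) (Kay k NB)) (nE : Embedding (Kay k HE) (Kay k NE)) →
  (∀ s → R NB (image (fun nB ∘ fun eB) s) ≡ R NE (image (fun nE ∘ fun eE) s)) →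
  Amalgam (InKay k) eB eE
Kay-amalgamate-via {k} {NB = NB} eB eE nB nE agree =
  let HD , _ , g , h , commute = amalgamate (restrict-embedding NB (inj (Embedding-trans eB nB))) A↪NE
  in Kay k HD , (HD , Iso-refl _) ,
     Embedding-trans nB (Kay-embedding g) , Embedding-trans nE (Kay-embedding h) , commute
  where
  A↪NE : Embedding (restrict NB (inj (Embedding-trans eB nB))) _
  A↪NE = record { fun = fun nE ∘ fun eE ; inj = inj (Embedding-trans eE nE) ; pres = agree }

Kay-amalgamate : ∀ {j} {A : Hyp (suc (suc j))} {HB HE : Hyp (suc j)}
  (eB : Embedding A (Kay (suc j) HB)) (eE : Embedding A (Kay (suc j) HE)) →
  Amalgam (InKay (suc j)) eB eE
Kay-amalgamate {A = record { size = zero }} {HB} {HE} eB eE =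
  Kay-amalgamate-via eB eE (emb (Iso-refl (Kay _ HB))) (emb (Iso-refl (Kay _ HE)))
    λ { [] → trans (R-⊥ HB) (sym (R-⊥ HE)) }
Kay-amalgamate {A = record { size = suc _ }} {HB} {HE} eB eE =
  Kay-amalgamate-via {NB = normalise HB vB} {NE = normalise HE vE} eB eE
    (emb (≗⇒Iso (sym ∘ kayR-normalise HB vB))) (emb (≗⇒Iso (sym ∘ kayR-normalise HE vE)))
    λ s → trans (normalR-image eB zero s) (sym (normalR-image eE zero s))
  where
  vB = fun eB zero
  vE = fun eE zero

kay-HP : ∀ k → HP (InKay k)
kay-HP k A B (H , B≅KH) A↪B = restrict H (inj e) , A≅K
  where
  e = Embedding-trans A↪B (emb B≅KH)
  A≅K : Iso A (Kay k (restrict H (inj e)))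
  A≅K = ≗⇒Iso λ s → trans (pres e s) (sym (pres (Kay-embedding (restrict-embedding H (inj e))) s))

kay-AP : ∀ j → AP (InKay (suc j))
kay-AP j A B E _ (HB , B≅KHB) (HE , E≅KHE) e f =
  let D , D∈K , g , h , commute = Kay-amalgamate (Embedding-trans e (emb B≅KHB)) (Embedding-trans f (emb E≅KHE))
  in D , D∈K , Embedding-trans (emb B≅KHB) g , Embedding-trans (emb E≅KHE) h , commute

∅ : ∀ {m} → Hyp m
∅ = record { size = 0 ; R = λ _ → false ; uniform = λ _ () }

∅-embedding : ∀ {m} (B : Hyp (suc m)) → Embedding ∅ B
∅-embedding B = record { fun = λ () ; inj = λ { {()} } ; pres = λ { [] → sym (R-⊥ B) } }

∅∈Kay : ∀ k → InKay k ∅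
∅∈Kay k = ∅ , ≗⇒Iso λ { [] → refl }

kay-JEP : ∀ j → JEP (InKay (suc j))
kay-JEP j A B A∈K B∈K =
  let D , D∈K , g , h , _ = kay-AP j ∅ A B (∅∈Kay (suc j)) A∈K B∈K (∅-embedding A) (∅-embedding B)
  in D , D∈K , g , h

-- The argument only needs k ≥ 1.
proposition3p3 : (k : ℕ) → 2 ≤ k →
    HP (InKay k) × JEP (InKay k) × AP (InKay k)
proposition3p3 (suc k) _ = kay-HP (suc k) , kay-JEP k , kay-AP k
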